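{- The complete bipartite graph $K_{2,3}$ is not JIS.
   Context: A graph $G$ is called JIS if there exist a positive integer $n$ and an assignment of an $n$-element set $S_v$ to each vertex $v$ of $G$ such that distinct vertices receive distinct sets, and for distinct vertices $v,w$, $v$ and $w$ are adjacent iff $|S_v \cap S_w| = n-1$ (equivalently, $G$ is isomorphic to an induced subgraph of a Johnson graph). -}

module Defs where

open import Data.Nat using (ℕ; _∸_; _≤_; _<_)
open import Data.Fin using (Fin; toℕ)
open import Data.Fin.Subset using (Subset; ∣_∣; _∩_)
open import Data.Product using (Σ; _×_; ∃-syntax)
open import Function.Bundles using (_⇔_)
open import Relation.Binary.PropositionalEquality using (_≡_; _≢_)
open import Data.Empty using (⊥)
open import Data.Bool using (Bool)
open import Data.Nat using (_<ᵇ_)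

record Graph : Set₁ where
  field
    order     : ℕ
    Adj       : Fin order → Fin order → Set
    irrefl    : ∀ v → Adj v v → ⊥
    symmetric : ∀ v w → Adj v w → Adj w v

open Graph public

JIS : Graph → Set
JIS G =
  ∃[ n ] ∃[ m ] Σ (Fin (order G) → Subset m) λ S →
    (1 ≤ n)
    × (∀ v → ∣ S v ∣ ≡ n)
    × (∀ v w → v ≢ w → S v ≢ S w)
    × (∀ v w → v ≢ w → (Adj G v w ⇔ (∣ S v ∩ S w ∣ ≡ n ∸ 1)))

-- K_{2,3}: vertices 0,1 form one side, vertices 2,3,4 the other;
-- two vertices are adjacent iff they lie on different sides.
K23-adj : Fin 5 → Fin 5 → Set
K23-adj v w = (toℕ v <ᵇ 2) ≢ (toℕ w <ᵇ 2)

open import Relation.Binary.PropositionalEquality using (refl; sym)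

K23 : Graph
K23 = record
  { order = 5
  ; Adj = K23-adj
  ; irrefl = λ v a → a refl
  ; symmetric = λ v w a e → a (sym e)
  }

module Submission where

-- Suppose A, B (one side) and X, Y, Z (other side) are distinct n-element
-- sets representing K_{2,3}.  Adjacent pairs meet in n - 1 elements, and
-- a non-adjacent pair of distinct n-sets meets in at most n - 2 elements.
-- The proof is a double count: for arbitrary sets A, B, X, Y, Z,
--
--   Σ_{P ∈ {A,B}, Q ∈ {X,Y,Z}} |P ∩ Q|  ≤  |A| + |B| + |A∩B| + |X∩Y| + |Y∩Z| + |Z∩X|,
--
-- which holds because it holds for the indicator bits of every single
-- element (a finite truth-table check) and cardinalities add up over
-- elements.  For a K_{2,3} representation the left side is 6(n-1) and the
-- right side is at most 2n + 4(n-2) = 6n - 8, a contradiction.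

open import Defs
open import Relation.Nullary using (¬_)
open import Data.Nat using (ℕ; zero; suc; _+_; _*_; _≤_; _<_; z≤n; s≤s; s≤s⁻¹)
open import Data.Nat.Properties
open import Data.Nat.Tactic.RingSolver using (solve-∀)
open import Data.Bool using (Bool; true; false; _∧_)
open import Data.Unit using (tt)
open import Data.Vec using (Vec; []; _∷_; map; sum; zipWith)
open import Data.Vec.Relation.Unary.All using (All; []; _∷_)
open import Data.Fin.Patterns using (0F; 1F; 2F; 3F; 4F)
open import Data.Fin.Subset using (Subset; ∣_∣; _∩_)
open import Data.Fin.Subset.Properties using (∣p∩q∣≤∣p∣; ∣p∩q∣≤∣q∣)
open import Data.Product using (_,_)
open import Function.Bundles using (Equivalence)
open import Relation.Binary.PropositionalEquality
open import Data.Empty using (⊥; ⊥-elim)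
open import Algebra.Properties.CommutativeSemigroup +-commutativeSemigroup
  using (interchange; x∙yz≈y∙xz)

bit : Bool → ℕ
bit true  = 1
bit false = 0

bitSum : ∀ {r} → Vec Bool r → ℕ
bitSum bs = sum (map bit bs)

total : ∀ {m r} → Vec (Subset m) r → ℕ
total ps = sum (map ∣_∣ ps)

∣∷∣ : ∀ {m} (b : Bool) (p : Subset m) → ∣ b ∷ p ∣ ≡ bit b + ∣ p ∣
∣∷∣ true  p = refl
∣∷∣ false p = refl

total-∷ : ∀ {m r} (bs : Vec Bool r) (ps : Vec (Subset m) r) →
          total (zipWith _∷_ bs ps) ≡ bitSum bs + total ps
total-∷ []       []       = refl
total-∷ (b ∷ bs) (p ∷ ps) =
  trans (cong₂ _+_ (∣∷∣ b p) (total-∷ bs ps)) (interchange (bit b) ∣ p ∣ (bitSum bs) (total ps))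

-- The six meets across the bipartition {a,b} | {x,y,z} (the edges of K_{2,3})
-- and the four meets within a side (its non-edges), for any meet operation;
-- for subsets a ∷ as, … they are the element-wise cons of the versions for
-- the bits a, … (meet _∧_) and for the tails as, … (meet _∩_).
crossMeets : ∀ {A : Set} → (A → A → A) → A → A → A → A → A → Vec A 6
crossMeets _⊓_ a b x y z = a ⊓ x ∷ a ⊓ y ∷ a ⊓ z ∷ b ⊓ x ∷ b ⊓ y ∷ b ⊓ z ∷ []

sideMeets : ∀ {A : Set} → (A → A → A) → A → A → A → A → A → Vec A 4
sideMeets _⊓_ a b x y z = a ⊓ b ∷ x ⊓ y ∷ y ⊓ z ∷ z ⊓ x ∷ []

-- Element-wise form of the counting inequality, for a point lying in exactly
-- one, respectively both, of a and b: if t of x, y, z contain it, then at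
-- least t - 1, respectively 2t - 3, of the pairs among x, y, z contain it.
oneSide : ∀ x y z → bitSum (x ∷ y ∷ z ∷ []) ≤ suc (bitSum (x ∧ y ∷ y ∧ z ∷ z ∧ x ∷ []))
oneSide true  true  true  = ≤ᵇ⇒≤ _ _ tt
oneSide true  true  false = ≤ᵇ⇒≤ _ _ tt
oneSide true  false true  = ≤ᵇ⇒≤ _ _ tt
oneSide true  false false = ≤ᵇ⇒≤ _ _ tt
oneSide false true  true  = ≤ᵇ⇒≤ _ _ tt
oneSide false true  false = ≤ᵇ⇒≤ _ _ tt
oneSide false false true  = ≤ᵇ⇒≤ _ _ tt
oneSide false false false = ≤ᵇ⇒≤ _ _ tt

bothSides : ∀ x y z →
  bitSum (x ∷ y ∷ z ∷ x ∷ y ∷ z ∷ []) ≤ 3 + bitSum (x ∧ y ∷ y ∧ z ∷ z ∧ x ∷ [])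
bothSides true  true  true  = ≤ᵇ⇒≤ _ _ tt
bothSides true  true  false = ≤ᵇ⇒≤ _ _ tt
bothSides true  false true  = ≤ᵇ⇒≤ _ _ tt
bothSides true  false false = ≤ᵇ⇒≤ _ _ tt
bothSides false true  true  = ≤ᵇ⇒≤ _ _ tt
bothSides false true  false = ≤ᵇ⇒≤ _ _ tt
bothSides false false true  = ≤ᵇ⇒≤ _ _ tt
bothSides false false false = ≤ᵇ⇒≤ _ _ tt

pointInequality : ∀ a b x y z →
  bitSum (crossMeets _∧_ a b x y z) ≤ bitSum (a ∷ b ∷ sideMeets _∧_ a b x y z)
pointInequality false false x y z = z≤n
pointInequality true  false x y z = oneSide x y z
pointInequality false true  x y z = oneSide x y z
pointInequality true  true  x y z = bothSides x y z

countingInequality : ∀ {m} (a b x y z : Subset m) →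
  total (crossMeets _∩_ a b x y z) ≤ total (a ∷ b ∷ sideMeets _∩_ a b x y z)
countingInequality [] [] [] [] [] = z≤n
countingInequality (a ∷ as) (b ∷ bs) (x ∷ xs) (y ∷ ys) (z ∷ zs) = begin
  total (crossMeets _∩_ (a ∷ as) (b ∷ bs) (x ∷ xs) (y ∷ ys) (z ∷ zs))
    ≡⟨ total-∷ (crossMeets _∧_ a b x y z) (crossMeets _∩_ as bs xs ys zs) ⟩
  bitSum (crossMeets _∧_ a b x y z) + total (crossMeets _∩_ as bs xs ys zs)
    ≤⟨ +-mono-≤ (pointInequality a b x y z) (countingInequality as bs xs ys zs) ⟩
  bitSum (a ∷ b ∷ sideMeets _∧_ a b x y z) + total (as ∷ bs ∷ sideMeets _∩_ as bs xs ys zs)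
    ≡⟨ total-∷ (a ∷ b ∷ sideMeets _∧_ a b x y z) (as ∷ bs ∷ sideMeets _∩_ as bs xs ys zs) ⟨
  total ((a ∷ as) ∷ (b ∷ bs) ∷ sideMeets _∩_ (a ∷ as) (b ∷ bs) (x ∷ xs) (y ∷ ys) (z ∷ zs)) ∎
  where open ≤-Reasoning

∩-full⇒≡ : ∀ {m} (p q : Subset m) → ∣ p ∩ q ∣ ≡ ∣ p ∣ → ∣ p ∩ q ∣ ≡ ∣ q ∣ → p ≡ q
∩-full⇒≡ []          []          _   _   = refl
∩-full⇒≡ (true  ∷ p) (true  ∷ q) e₁  e₂  = cong (true ∷_) (∩-full⇒≡ p q (suc-injective e₁) (suc-injective e₂))
∩-full⇒≡ (true  ∷ p) (false ∷ q) e₁  _   = ⊥-elim (<⇒≢ (s≤s (∣p∩q∣≤∣p∣ p q)) e₁)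
∩-full⇒≡ (false ∷ p) (true  ∷ q) _   e₂  = ⊥-elim (<⇒≢ (s≤s (∣p∩q∣≤∣q∣ p q)) e₂)
∩-full⇒≡ (false ∷ p) (false ∷ q) e₁  e₂  = cong (false ∷_) (∩-full⇒≡ p q e₁ e₂)

nonAdjacentMeet : ∀ {m} k (p q : Subset m) → ∣ p ∣ ≡ suc k → ∣ q ∣ ≡ suc k →
                  p ≢ q → ∣ p ∩ q ∣ ≢ k → ∣ p ∩ q ∣ < k
nonAdjacentMeet k p q ∣p∣≡ ∣q∣≡ p≢q ≢k = ≤∧≢⇒< (s≤s⁻¹ (≤∧≢⇒< ≤suc-k ≢suc-k)) ≢k
  where
  ≤suc-k : ∣ p ∩ q ∣ ≤ suc k
  ≤suc-k = subst (∣ p ∩ q ∣ ≤_) ∣p∣≡ (∣p∩q∣≤∣p∣ p q)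
  ≢suc-k : ∣ p ∩ q ∣ ≢ suc k
  ≢suc-k e = p≢q (∩-full⇒≡ p q (trans e (sym ∣p∣≡)) (trans e (sym ∣q∣≡)))

total-constant : ∀ {m r c} {ps : Vec (Subset m) r} → All (λ p → ∣ p ∣ ≡ c) ps → total ps ≡ r * c
total-constant []       = refl
total-constant (e ∷ es) = cong₂ _+_ e (total-constant es)

total-bounded : ∀ {m r c} {ps : Vec (Subset m) r} → All (λ p → ∣ p ∣ < c) ps → r + total ps ≤ r * c
total-bounded []                       = z≤n
total-bounded {r = suc r} {c} {p ∷ ps} (lt ∷ lts) =
  subst (_≤ c + r * c) (cong suc (x∙yz≈y∙xz ∣ p ∣ r (total ps))) (+-mono-≤ lt (total-bounded lts))

-- The arithmetic at the end of the double count: six meets of size k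
-- cannot fit into two sets of size k + 1 and four meets of size < k.
doubleCountClash : ∀ k t → 4 + t ≤ 4 * k → ¬ (6 * k ≤ suc k + (suc k + t))
doubleCountClash k t small big = m+1+n≰m (suc k + (suc k + t)) (begin
  suc k + (suc k + t) + 2 ≡⟨ regroup k t ⟩
  2 * k + (4 + t)         ≤⟨ +-monoʳ-≤ (2 * k) small ⟩
  2 * k + 4 * k           ≡⟨ six k ⟩
  6 * k                   ≤⟨ big ⟩
  suc k + (suc k + t)     ∎)
  where
  open ≤-Reasoning
  regroup : ∀ k t → suc k + (suc k + t) + 2 ≡ 2 * k + (4 + t)
  regroup = solve-∀
  six : ∀ k → 2 * k + 4 * k ≡ 6 * k
  six = solve-∀

noK23Meets : ∀ {m} k (a b x y z : Subset m) → ∣ a ∣ ≡ suc k → ∣ b ∣ ≡ suc k →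
  All (λ p → ∣ p ∣ ≡ k) (crossMeets _∩_ a b x y z) →
  All (λ p → ∣ p ∣ < k) (sideMeets _∩_ a b x y z) → ⊥
noK23Meets k a b x y z ∣a∣≡ ∣b∣≡ cross side =
  doubleCountClash k (total (sideMeets _∩_ a b x y z)) (total-bounded side) (begin
    6 * k                                      ≡⟨ total-constant cross ⟨
    total (crossMeets _∩_ a b x y z)           ≤⟨ countingInequality a b x y z ⟩
    total (a ∷ b ∷ sideMeets _∩_ a b x y z)    ≡⟨ cong₂ (λ u v → u + (v + total (sideMeets _∩_ a b x y z))) ∣a∣≡ ∣b∣≡ ⟩
    suc k + (suc k + total (sideMeets _∩_ a b x y z)) ∎)
  where open ≤-Reasoning

proposition8 : ¬ JIS K23
proposition8 (zero  , _ , _ , ()  , _)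
proposition8 (suc k , _ , S , _ , size , distinct , adj) =
  noK23Meets k (S 0F) (S 1F) (S 2F) (S 3F) (S 4F) (size 0F) (size 1F)
    (edge 0F 2F (λ ()) (λ ()) ∷ edge 0F 3F (λ ()) (λ ()) ∷ edge 0F 4F (λ ()) (λ ()) ∷
     edge 1F 2F (λ ()) (λ ()) ∷ edge 1F 3F (λ ()) (λ ()) ∷ edge 1F 4F (λ ()) (λ ()) ∷ [])
    (nonEdge 0F 1F (λ ()) (λ vw → vw refl) ∷ nonEdge 2F 3F (λ ()) (λ vw → vw refl) ∷
     nonEdge 3F 4F (λ ()) (λ vw → vw refl) ∷ nonEdge 4F 2F (λ ()) (λ vw → vw refl) ∷ [])
  where
  edge : ∀ v w → v ≢ w → K23-adj v w → ∣ S v ∩ S w ∣ ≡ k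
  edge v w v≢w = Equivalence.to (adj v w v≢w)
  nonEdge : ∀ v w → v ≢ w → ¬ K23-adj v w → ∣ S v ∩ S w ∣ < k
  nonEdge v w v≢w ¬vw = nonAdjacentMeet k (S v) (S w) (size v) (size w) (distinct v w v≢w)
                                        (λ meet → ¬vw (Equivalence.from (adj v w v≢w) meet))
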